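{- Let $(a_N)_{N\ge1}$ be Stern's triatomic sequence. For every $n\ge1$, every $j_2,\dots,j_n\in\{0,1,2\}$ and every $k\in\{1,2,3\}$, if $N=\tau(0,j_2,\dots,j_n;k)$ then $$a_N=a_{N+3^n}=a_{N+2\cdot 3^n},$$ i.e. $a_{\tau(0,j_2,\dots,j_n;k)}=a_{\tau(1,j_2,\dots,j_n;k)}=a_{\tau(2,j_2,\dots,j_n;k)}$.
   Context: Let $A_0=\begin{pmatrix}1&0&1\\0&1&1\\0&0&1\end{pmatrix}$, $A_1=\begin{pmatrix}0&0&1\\1&0&1\\0&1&1\end{pmatrix}$, $A_2=\begin{pmatrix}0&1&1\\0&0&1\\1&0&1\end{pmatrix}$. For a tuple $I=(i_1,\dots,i_n)$ with $i_j\in\{0,1,2\}$ ($n\ge0$) set $(v_1(I),v_2(I),v_3(I))=(1,1,1)A_{i_1}\cdots A_{i_n}$. Define $\tau(i_1,\dots,i_n;k)=\frac{3(3^n-1)}{2}+i_13^n+i_23^{n-1}+\cdots+i_n3+k$ for $k\in\{1,2,3\}$; every positive integer is $\tau(I;k)$ for exactly one pair $(I,k)$. Stern's triatomic sequence is $a_{\tau(I;k)}=v_k(I)$. -}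

module Defs where

open import Data.Nat using (ℕ; zero; suc; _+_; _*_; _∸_; _^_)
open import Data.Fin using (Fin; zero; suc; toℕ)
open import Data.List using (List; []; _∷_; length)
open import Relation.Binary.PropositionalEquality using (_≡_)

Mat3 : Set
Mat3 = Fin 3 → Fin 3 → ℕ

Row3 : Set
Row3 = Fin 3 → ℕ

_·M_ : Row3 → Mat3 → Row3
(v ·M M) j = v zero * M zero j + v (suc zero) * M (suc zero) j + v (suc (suc zero)) * M (suc (suc zero)) j

mk : ℕ → ℕ → ℕ → ℕ → ℕ → ℕ → ℕ → ℕ → ℕ → Mat3
mk a b c d e f g h i zero zero = a
mk a b c d e f g h i zero (suc zero) = b
mk a b c d e f g h i zero (suc (suc zero)) = c
mk a b c d e f g h i (suc zero) zero = d
mk a b c d e f g h i (suc zero) (suc zero) = e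
mk a b c d e f g h i (suc zero) (suc (suc zero)) = f
mk a b c d e f g h i (suc (suc zero)) zero = g
mk a b c d e f g h i (suc (suc zero)) (suc zero) = h
mk a b c d e f g h i (suc (suc zero)) (suc (suc zero)) = i

A : Fin 3 → Mat3
A zero = mk 1 0 1  0 1 1  0 0 1
A (suc zero) = mk 0 0 1  1 0 1  0 1 1
A (suc (suc zero)) = mk 0 1 1  0 0 1  1 0 1

ones : Row3
ones _ = 1

-- (v₁(I), v₂(I), v₃(I)) = (1,1,1) A_{i₁} ⋯ A_{iₙ}
-- (left-to-right product, accumulated from the left)
vecAcc : Row3 → List (Fin 3) → Row3
vecAcc w [] = w
vecAcc w (i ∷ I) = vecAcc (w ·M A i) I

v : List (Fin 3) → Row3
v I = vecAcc ones I

digits : List (Fin 3) → ℕ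
digits [] = 0
digits (i ∷ I) = toℕ i * 3 ^ suc (length I) + digits I

-- τ(I; k) = 3(3ⁿ-1)/2 + i₁3ⁿ + ⋯ + iₙ3 + k, with k ∈ {1,2,3} encoded as Fin 3 (k = toℕ k' + 1)
-- 3(3ⁿ-1)/2 is written as the sum 3 + 3² + ⋯ + 3ⁿ
geom : ℕ → ℕ
geom zero = 0
geom (suc n) = 3 ^ suc n + geom n

τ : List (Fin 3) → Fin 3 → ℕ
τ I k = geom (length I) + digits I + suc (toℕ k)

-- a : ℕ → ℕ is Stern's triatomic sequence: a_{τ(I;k)} = v_k(I) for all (I,k).
-- Since τ is a bijection onto the positive integers, this determines a on N ≥ 1.
IsSternTriatomic : (ℕ → ℕ) → Set
IsSternTriatomic a = ∀ (I : List (Fin 3)) (k : Fin 3) → a (τ I k) ≡ v I k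

-- Every A_i has column sums (1, 1, 3), so (1,1,1)A_i does not depend on i. Hence
-- v(i, j₂, …, jₙ) does not depend on the leading digit i, while changing that digit
-- from 0 to i moves τ by exactly i·3ⁿ.
module Submission where

open import Defs
open import Data.Nat using (ℕ; suc; _+_; _*_; _^_)
open import Data.Nat.Properties using (*-identityˡ)
open import Data.Nat.Tactic.RingSolver using (solve-∀)
open import Data.Fin using (Fin; zero; suc; toℕ)
open import Data.List using (List; []; _∷_; length)
open import Data.Product using (_×_; _,_)
open import Relation.Binary.PropositionalEquality
  using (_≡_; _≗_; refl; sym; trans; cong; module ≡-Reasoning)

·M-cong : ∀ {w u : Row3} → w ≗ u → ∀ M → (w ·M M) ≗ (u ·M M)
·M-cong w≗u M j
  rewrite w≗u zero | w≗u (suc zero) | w≗u (suc (suc zero)) = refl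

vecAcc-cong : ∀ {w u : Row3} → w ≗ u → ∀ I → vecAcc w I ≗ vecAcc u I
vecAcc-cong w≗u []      = w≗u
vecAcc-cong w≗u (i ∷ I) = vecAcc-cong (·M-cong w≗u (A i)) I

ones·A-independent : ∀ i → (ones ·M A i) ≗ (ones ·M A zero)
ones·A-independent zero             _                = refl
ones·A-independent (suc zero)       zero             = refl
ones·A-independent (suc zero)       (suc zero)       = refl
ones·A-independent (suc zero)       (suc (suc zero)) = refl
ones·A-independent (suc (suc zero)) zero             = refl
ones·A-independent (suc (suc zero)) (suc zero)       = refl
ones·A-independent (suc (suc zero)) (suc (suc zero)) = refl

v-head-irrelevant : ∀ i j J → v (i ∷ J) ≗ v (j ∷ J)
v-head-irrelevant i j J k = begin
  v (i ∷ J) k                 ≡⟨ vecAcc-cong (ones·A-independent i) J k ⟩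
  vecAcc (ones ·M A zero) J k ≡⟨ vecAcc-cong (ones·A-independent j) J k ⟨
  v (j ∷ J) k                 ∎
  where open ≡-Reasoning

τ-head : ∀ i J k → τ (i ∷ J) k ≡ τ (zero ∷ J) k + toℕ i * 3 ^ suc (length J)
τ-head i J k = shift (geom (suc (length J))) (toℕ i * 3 ^ suc (length J)) (digits J) (suc (toℕ k))
  where
  shift : ∀ g x d c → g + (x + d) + c ≡ g + d + c + x
  shift = solve-∀

stern-head-irrelevant : ∀ a → IsSternTriatomic a →
  ∀ i j J k → a (τ (i ∷ J) k) ≡ a (τ (j ∷ J) k)
stern-head-irrelevant a stern i j J k = begin
  a (τ (i ∷ J) k) ≡⟨ stern (i ∷ J) k ⟩
  v (i ∷ J) k     ≡⟨ v-head-irrelevant i j J k ⟩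
  v (j ∷ J) k     ≡⟨ stern (j ∷ J) k ⟨
  a (τ (j ∷ J) k) ∎
  where open ≡-Reasoning

mainTheorem3 : (a : ℕ → ℕ) → IsSternTriatomic a →
    ∀ (J : List (Fin 3)) (k : Fin 3) →
      let n = suc (length J)
          N = τ (zero ∷ J) k
      in (a N ≡ a (N + 3 ^ n) × a (N + 3 ^ n) ≡ a (N + 2 * 3 ^ n))
         × (a (τ (zero ∷ J) k) ≡ a (τ (suc zero ∷ J) k)
            × a (τ (suc zero ∷ J) k) ≡ a (τ (suc (suc zero) ∷ J) k))
mainTheorem3 a stern J k =
  ( trans a₀≡a₁ (cong a τ₁≡N+3ⁿ)
  , trans (cong a (sym τ₁≡N+3ⁿ)) (trans a₁≡a₂ (cong a (τ-head (suc (suc zero)) J k))) )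
  , (a₀≡a₁ , a₁≡a₂)
  where
  a₀≡a₁ : a (τ (zero ∷ J) k) ≡ a (τ (suc zero ∷ J) k)
  a₀≡a₁ = stern-head-irrelevant a stern zero (suc zero) J k
  a₁≡a₂ : a (τ (suc zero ∷ J) k) ≡ a (τ (suc (suc zero) ∷ J) k)
  a₁≡a₂ = stern-head-irrelevant a stern (suc zero) (suc (suc zero)) J k
  τ₁≡N+3ⁿ : τ (suc zero ∷ J) k ≡ τ (zero ∷ J) k + 3 ^ suc (length J)
  τ₁≡N+3ⁿ = trans (τ-head (suc zero) J k)
                  (cong (τ (zero ∷ J) k +_) (*-identityˡ (3 ^ suc (length J))))
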